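{- For all $n \ge 1$, there exists a bijection between $S_n(132, 213, 2341)$ and the set of tilings of a $1 \times (n+1)$ rectangle with tiles of sizes $1\times 1$ and $1\times 2$ that use at least one $1\times 2$ tile. In particular, for all $n \ge 1$, $$|S_n(132, 213, 2341)| = F_{n+2} - 1.$$
   Context: Permutations of $[n]$ are written in one-line notation, and $S_n$ denotes the set of them. A permutation $\pi\in S_n$ contains $\sigma\in S_m$ if there are indices $i_1<\dots<i_m$ such that for all $a,b$, $\pi(i_a)<\pi(i_b)$ iff $\sigma(a)<\sigma(b)$; otherwise $\pi$ avoids $\sigma$. For a set $R$ of permutations, $S_n(R)$ is the set of $\pi\in S_n$ avoiding every element of $R$. $F_n$ denotes the Fibonacci numbers with $F_0=0$, $F_1=F_2=1$, $F_n=F_{n-1}+F_{n-2}$. -}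

module Defs where

open import Level using (0ℓ)
open import Data.Nat using (ℕ; zero; suc; _+_)
open import Data.Fin using (Fin; zero; suc; _<_)
open import Data.Vec using (Vec; []; _∷_; lookup)
open import Data.List using (List; []; _∷_)
open import Data.List.Relation.Unary.Any using (Any)
open import Data.Product using (Σ; ∃; _×_; proj₁)
open import Function.Bundles using (_⇔_)
open import Relation.Nullary using (¬_)
open import Relation.Binary.Bundles using (Setoid)
open import Relation.Binary.PropositionalEquality using (_≡_)
import Relation.Binary.PropositionalEquality as ≡
import Relation.Binary.Construct.On as On

F : ℕ → ℕ
F zero = 0
F (suc zero) = 1
F (suc (suc n)) = F (suc n) + F n

-- A permutation of [n] in one-line notation: a word π(1)…π(n) over [n]
-- (values 0-indexed as Fin n) with no repeated letter, i.e. i ↦ π(i) is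
-- injective, hence a bijection of the finite set [n].
IsPerm : ∀ {n} → Vec (Fin n) n → Set
IsPerm {n} π = ∀ (i j : Fin n) → lookup π i ≡ lookup π j → i ≡ j

Contains : ∀ {n m} → Vec (Fin n) n → Vec (Fin m) m → Set
Contains {n} {m} π σ =
  Σ (Fin m → Fin n) λ ι →
    (∀ (a b : Fin m) → a < b → ι a < ι b) ×
    (∀ (a b : Fin m) → (lookup π (ι a) < lookup π (ι b)) ⇔ (lookup σ a < lookup σ b))

Avoids : ∀ {n m} → Vec (Fin n) n → Vec (Fin m) m → Set
Avoids π σ = ¬ Contains π σ

-- the patterns 132, 213, 2341 (values shifted down by one)
p132 : Vec (Fin 3) 3
p132 = zero ∷ suc (suc zero) ∷ suc zero ∷ []

p213 : Vec (Fin 3) 3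
p213 = suc zero ∷ zero ∷ suc (suc zero) ∷ []

p2341 : Vec (Fin 4) 4
p2341 = suc zero ∷ suc (suc zero) ∷ suc (suc (suc zero)) ∷ zero ∷ []

Sn-132-213-2341 : ℕ → Set
Sn-132-213-2341 n =
  Σ (Vec (Fin n) n) λ π → IsPerm π × Avoids π p132 × Avoids π p213 × Avoids π p2341

Sn-132-213-2341-setoid : ℕ → Setoid 0ℓ 0ℓ
Sn-132-213-2341-setoid n = On.setoid {B = Sn-132-213-2341 n} (≡.setoid (Vec (Fin n) n)) proj₁

-- tiles of a 1 × k rectangle, listed from left to right
data Tile : Set where
  square domino : Tile

size : Tile → ℕ
size square = 1
size domino = 2

totalLength : List Tile → ℕ
totalLength [] = 0
totalLength (t ∷ ts) = size t + totalLength ts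

TilingWithDomino : ℕ → Set
TilingWithDomino k =
  Σ (List Tile) λ ts → (totalLength ts ≡ k) × Any (_≡ domino) ts

TilingWithDomino-setoid : ℕ → Setoid 0ℓ 0ℓ
TilingWithDomino-setoid k = On.setoid {B = TilingWithDomino k} (≡.setoid (List Tile)) proj₁

-- Since 132, 213 and 2341 are skew-indecomposable, 1 ⊖ σ and 12 ⊖ σ avoid them whenever σ
-- does.  Conversely, let π avoid them.  If π starts with its greatest entry, π = 1 ⊖ σ.  If it
-- starts with its least entry, it is increasing (else 132).  Otherwise its greatest entry comes
-- second (else 213 or 2341) and its first entry is the second greatest (else 132), so π = 12 ⊖ σ.
-- Reading an identity as a domino followed by squares, 1 ⊖ _ as a leading square and 12 ⊖ _ as a
-- leading domino gives the bijection with tilings; their number obeys the Fibonacci recursion.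

module Submission where

open import Defs
open import Data.Nat using (ℕ; _≤_; _+_; _∸_)
open import Data.Fin using (Fin)
open import Data.Product using (_×_)
open import Function.Bundles using (Inverse)
open import Relation.Binary.PropositionalEquality using (setoid)
open import Data.Nat using (zero; suc; _<_; z≤n; s≤s; z<s; s<s; _≟_)
open import Data.Nat.Properties
open import Data.Fin as Fin using (zero; suc; toℕ; inject₁; fromℕ; fromℕ<; punchOut; _↑ˡ_; _↑ʳ_; splitAt; join)
import Data.Fin.Properties as Finₚ
open import Data.Vec using (Vec; []; _∷_; lookup; tabulate)
import Data.Vec.Properties as Vecₚ
open import Data.List using (List; []; _∷_; replicate)
open import Data.List.Relation.Unary.Any using (Any; here; there)
open import Data.Product using (Σ; ∃; ∃₂; _,_; proj₁; proj₂; map)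
open import Data.Sum using (_⊎_; inj₁; inj₂; [_,_])
open import Data.Empty using (⊥; ⊥-elim)
open import Function using (_∘_)
open import Function.Bundles using (Equivalence; mk⇔)
open import Function.Definitions using (Injective)
import Function.Construct.Composition as Compose
open import Level using (0ℓ)
open import Relation.Binary.Bundles using (Setoid)
open import Relation.Nullary using (¬_; yes; no)
open import Relation.Binary using (tri<; tri≈; tri>)
open import Relation.Binary.PropositionalEquality
  using (_≡_; _≢_; _≗_; refl; sym; trans; cong; cong₂; subst; subst₂; module ≡-Reasoning)

entries : ∀ {n} → Vec (Fin n) n → Fin n → ℕ
entries π = toℕ ∘ lookup π

increasing-if-consecutive : ∀ {m} (x : Fin (suc m) → ℕ) → (∀ i → x (inject₁ i) < x (suc i)) →
                            ∀ {a b} → a Fin.< b → x a < x b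
increasing-if-consecutive x step {zero} {suc zero} _ = step zero
increasing-if-consecutive x step {zero} {suc (suc b)} _ =
  <-trans (step zero) (increasing-if-consecutive (x ∘ suc) (step ∘ suc) {zero} {suc b} z<s)
increasing-if-consecutive {zero} x step {suc ()}
increasing-if-consecutive {suc m} x step {suc a} {suc b} (s<s a<b) =
  increasing-if-consecutive (x ∘ suc) (step ∘ suc) a<b

-- σ⁻¹ lists the places of σ by increasing value, so only consecutive positions and
-- consecutive values need to be compared.
module _ {n m} (π : Vec (Fin n) n) (σ σ⁻¹ : Vec (Fin (suc m)) (suc m))
         (σ⁻¹∘σ : ∀ a → lookup σ⁻¹ (lookup σ a) ≡ a) where

  contains-if-embedded :
    (ι : Vec (Fin n) (suc m)) → (∀ i → lookup ι (inject₁ i) Fin.< lookup ι (suc i)) →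
    (∀ r → entries π (lookup ι (lookup σ⁻¹ (inject₁ r))) < entries π (lookup ι (lookup σ⁻¹ (suc r)))) →
    Contains π σ
  contains-if-embedded ι sorted ranked =
    lookup ι , (λ _ _ → increasing-if-consecutive (toℕ ∘ lookup ι) sorted) ,
    λ a b → mk⇔ (reflect a b) (preserve a b)
    where
    w : Fin (suc m) → ℕ
    w = entries π ∘ lookup ι

    preserve : ∀ a b → lookup σ a Fin.< lookup σ b → w a < w b
    preserve a b σa<σb = subst₂ (λ a′ b′ → w a′ < w b′) (σ⁻¹∘σ a) (σ⁻¹∘σ b)
      (increasing-if-consecutive (w ∘ lookup σ⁻¹) ranked σa<σb)

    reflect : ∀ a b → w a < w b → lookup σ a Fin.< lookup σ b
    reflect a b wa<wb with Finₚ.<-cmp (lookup σ a) (lookup σ b)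
    ... | tri< σa<σb _ _ = σa<σb
    ... | tri≈ _ σa≡σb _ = ⊥-elim (<-irrefl (cong w a≡b) wa<wb)
      where
      a≡b : a ≡ b
      a≡b = trans (sym (σ⁻¹∘σ a)) (trans (cong (lookup σ⁻¹) σa≡σb) (σ⁻¹∘σ b))
    ... | tri> _ _ σb<σa = ⊥-elim (<-asym wa<wb (preserve b a σb<σa))

data Forbidden {n} (w : Fin n → ℕ) : Set where
  occ132  : ∀ {i j k} → i Fin.< j → j Fin.< k → w i < w k → w k < w j → Forbidden w
  occ213  : ∀ {i j k} → i Fin.< j → j Fin.< k → w j < w i → w i < w k → Forbidden w
  occ2341 : ∀ {i j k l} → i Fin.< j → j Fin.< k → k Fin.< l →
            w l < w i → w i < w j → w j < w k → Forbidden w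

module _ {n} (π : Vec (Fin n) n) where

  forbidden⇒contains : Forbidden (entries π) → Contains π p132 ⊎ Contains π p213 ⊎ Contains π p2341
  forbidden⇒contains (occ132 {i} {j} {k} i<j j<k ik kj) = inj₁
    (contains-if-embedded π p132 p132 (λ { zero → refl ; (suc zero) → refl ; (suc (suc zero)) → refl })
      (i ∷ j ∷ k ∷ []) (λ { zero → i<j ; (suc zero) → j<k }) (λ { zero → ik ; (suc zero) → kj }))
  forbidden⇒contains (occ213 {i} {j} {k} i<j j<k ji ik) = inj₂ (inj₁
    (contains-if-embedded π p213 p213 (λ { zero → refl ; (suc zero) → refl ; (suc (suc zero)) → refl })
      (i ∷ j ∷ k ∷ []) (λ { zero → i<j ; (suc zero) → j<k }) (λ { zero → ji ; (suc zero) → ik })))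
  forbidden⇒contains (occ2341 {i} {j} {k} {l} i<j j<k k<l li ij jk) = inj₂ (inj₂
    (contains-if-embedded π p2341 p2341⁻¹
      (λ { zero → refl ; (suc zero) → refl ; (suc (suc zero)) → refl ; (suc (suc (suc zero))) → refl })
      (i ∷ j ∷ k ∷ l ∷ []) (λ { zero → i<j ; (suc zero) → j<k ; (suc (suc zero)) → k<l })
      (λ { zero → li ; (suc zero) → ij ; (suc (suc zero)) → jk })))
    where
    p2341⁻¹ : Vec (Fin 4) 4
    p2341⁻¹ = suc (suc (suc zero)) ∷ zero ∷ suc zero ∷ suc (suc zero) ∷ []

  contains132⇒forbidden : Contains π p132 → Forbidden (entries π)
  contains132⇒forbidden (ι , sorted , order) =
    occ132 (sorted zero (suc zero) z<s) (sorted (suc zero) (suc (suc zero)) (s<s z<s))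
      (Equivalence.from (order zero (suc (suc zero))) z<s)
      (Equivalence.from (order (suc (suc zero)) (suc zero)) (s<s z<s))

  contains213⇒forbidden : Contains π p213 → Forbidden (entries π)
  contains213⇒forbidden (ι , sorted , order) =
    occ213 (sorted zero (suc zero) z<s) (sorted (suc zero) (suc (suc zero)) (s<s z<s))
      (Equivalence.from (order (suc zero) zero) z<s)
      (Equivalence.from (order zero (suc (suc zero))) (s<s z<s))

  contains2341⇒forbidden : Contains π p2341 → Forbidden (entries π)
  contains2341⇒forbidden (ι , sorted , order) =
    occ2341 (sorted zero (suc zero) z<s) (sorted (suc zero) (suc (suc zero)) (s<s z<s))
      (sorted (suc (suc zero)) (suc (suc (suc zero))) (s<s (s<s z<s)))
      (Equivalence.from (order (suc (suc (suc zero))) zero) z<s)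
      (Equivalence.from (order zero (suc zero)) (s<s z<s))
      (Equivalence.from (order (suc zero) (suc (suc zero))) (s<s (s<s z<s)))

module _ {n} {w w′ : Fin n → ℕ} (w≗w′ : w ≗ w′) where
  private
    resp : ∀ {a b} → w a < w b → w′ a < w′ b
    resp {a} {b} = subst₂ _<_ (w≗w′ a) (w≗w′ b)

  forbidden-resp-≗ : Forbidden w → Forbidden w′
  forbidden-resp-≗ (occ132 i<j j<k ik kj) = occ132 i<j j<k (resp ik) (resp kj)
  forbidden-resp-≗ (occ213 i<j j<k ji ik) = occ213 i<j j<k (resp ji) (resp ik)
  forbidden-resp-≗ (occ2341 i<j j<k k<l li ij jk) = occ2341 i<j j<k k<l (resp li) (resp ij) (resp jk)

record Admissible {n} (w : Fin n → ℕ) : Set where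
  field
    bounded   : ∀ i → w i < n
    injective : Injective _≡_ _≡_ w
    avoiding  : ¬ Forbidden w
open Admissible

admissible-resp-≗ : ∀ {n} {w w′ : Fin n → ℕ} → w ≗ w′ → Admissible w → Admissible w′
admissible-resp-≗ {w = w} {w′} w≗w′ adm = record
  { bounded   = λ i → subst (_< _) (w≗w′ i) (bounded adm i)
  ; injective = λ {i} {j} e → injective adm (trans (w≗w′ i) (trans e (sym (w≗w′ j))))
  ; avoiding  = avoiding adm ∘ forbidden-resp-≗ (sym ∘ w≗w′)
  }

module _ {n : ℕ} where

  sn⇒admissible : (x : Sn-132-213-2341 n) → Admissible (entries (proj₁ x))
  sn⇒admissible (π , isPerm , avoids132 , avoids213 , avoids2341) = record
    { bounded   = Finₚ.toℕ<n ∘ lookup π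
    ; injective = λ {i} {j} e → isPerm i j (Finₚ.toℕ-injective e)
    ; avoiding  = [ avoids132 , [ avoids213 , avoids2341 ] ] ∘ forbidden⇒contains π
    }

  admissible⇒sn : ∀ {π : Vec (Fin n) n} → Admissible (entries π) → Sn-132-213-2341 n
  admissible⇒sn {π} adm =
    π , (λ i j e → injective adm (cong toℕ e)) ,
    avoiding adm ∘ contains132⇒forbidden π ,
    avoiding adm ∘ contains213⇒forbidden π ,
    avoiding adm ∘ contains2341⇒forbidden π

  tabulateBounded : (w : Fin n → ℕ) → (∀ i → w i < n) → Vec (Fin n) n
  tabulateBounded w bounded = tabulate (λ i → fromℕ< (bounded i))

  entries-tabulateBounded : ∀ (w : Fin n → ℕ) bounded → entries (tabulateBounded w bounded) ≗ w
  entries-tabulateBounded w bounded i =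
    trans (cong toℕ (Vecₚ.lookup∘tabulate _ i)) (Finₚ.toℕ-fromℕ< (bounded i))

  entries-injective : ∀ {π π′ : Vec (Fin n) n} → entries π ≗ entries π′ → π ≡ π′
  entries-injective {π} {π′} eq = begin
    π                   ≡⟨ sym (Vecₚ.tabulate∘lookup π) ⟩
    tabulate (lookup π)  ≡⟨ Vecₚ.tabulate-cong (Finₚ.toℕ-injective ∘ eq) ⟩
    tabulate (lookup π′) ≡⟨ Vecₚ.tabulate∘lookup π′ ⟩
    π′                  ∎
    where open ≡-Reasoning

1⊖_ : ∀ {n} → (Fin n → ℕ) → Fin (suc n) → ℕ
(1⊖_ {n} w) zero    = n
(1⊖ w)      (suc i) = w i

12⊖_ : ∀ {n} → (Fin n → ℕ) → Fin (suc (suc n)) → ℕ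
(12⊖_ {n} w) zero          = n
(12⊖_ {n} w) (suc zero)    = suc n
(12⊖ w)      (suc (suc i)) = w i

forbidden-suc : ∀ {n} {w : Fin (suc n) → ℕ} → Forbidden (w ∘ suc) → Forbidden w
forbidden-suc (occ132 i<j j<k ik kj) = occ132 (s<s i<j) (s<s j<k) ik kj
forbidden-suc (occ213 i<j j<k ji ik) = occ213 (s<s i<j) (s<s j<k) ji ik
forbidden-suc (occ2341 i<j j<k k<l li ij jk) = occ2341 (s<s i<j) (s<s j<k) (s<s k<l) li ij jk

-- In each of 132, 213, 2341 the first entry is exceeded by an entry at least two places later.
forbidden-head-or-tail : ∀ {n} {w : Fin (suc n) → ℕ} → Forbidden w →
  (∃₂ λ (j k : Fin (suc n)) → 0 < toℕ j × j Fin.< k × w zero < w k) ⊎ Forbidden (w ∘ suc)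
forbidden-head-or-tail (occ132 {zero} i<j j<k ik _) = inj₁ (_ , _ , i<j , j<k , ik)
forbidden-head-or-tail (occ132 {suc _} {zero} () _ _ _)
forbidden-head-or-tail (occ132 {suc _} {suc _} {zero} _ () _ _)
forbidden-head-or-tail (occ132 {suc _} {suc _} {suc _} (s<s i<j) (s<s j<k) ik kj) =
  inj₂ (occ132 i<j j<k ik kj)
forbidden-head-or-tail (occ213 {zero} i<j j<k _ ik) = inj₁ (_ , _ , i<j , j<k , ik)
forbidden-head-or-tail (occ213 {suc _} {zero} () _ _ _)
forbidden-head-or-tail (occ213 {suc _} {suc _} {zero} _ () _ _)
forbidden-head-or-tail (occ213 {suc _} {suc _} {suc _} (s<s i<j) (s<s j<k) ji ik) =
  inj₂ (occ213 i<j j<k ji ik)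
forbidden-head-or-tail (occ2341 {zero} i<j j<k _ _ ij jk) = inj₁ (_ , _ , i<j , j<k , <-trans ij jk)
forbidden-head-or-tail (occ2341 {suc _} {zero} () _ _ _ _ _)
forbidden-head-or-tail (occ2341 {suc _} {suc _} {zero} _ () _ _ _ _)
forbidden-head-or-tail (occ2341 {suc _} {suc _} {suc _} {zero} _ _ () _ _ _)
forbidden-head-or-tail (occ2341 {suc _} {suc _} {suc _} {suc _} (s<s i<j) (s<s j<k) (s<s k<l) li ij jk) =
  inj₂ (occ2341 i<j j<k k<l li ij jk)

avoiding-cons : ∀ {n} {w : Fin (suc n) → ℕ} →
  (∀ {j k : Fin (suc n)} → 0 < toℕ j → j Fin.< k → w k < w zero) → ¬ Forbidden (w ∘ suc) → ¬ Forbidden w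
avoiding-cons below avoids occ with forbidden-head-or-tail occ
... | inj₁ (_ , _ , 0<j , j<k , rise) = <-asym rise (below 0<j j<k)
... | inj₂ occ′ = avoids occ′

injective-cons : ∀ {n} {w : Fin (suc n) → ℕ} → (∀ i → w (suc i) ≢ w zero) →
  Injective _≡_ _≡_ (w ∘ suc) → Injective _≡_ _≡_ w
injective-cons fresh inj {zero}  {zero}  _ = refl
injective-cons fresh inj {zero}  {suc j} e = ⊥-elim (fresh j (sym e))
injective-cons fresh inj {suc i} {zero}  e = ⊥-elim (fresh i e)
injective-cons fresh inj {suc i} {suc j} e = cong suc (inj e)

toℕ-admissible : ∀ {n} → Admissible (toℕ {n})
toℕ-admissible = record
  { bounded   = Finₚ.toℕ<n
  ; injective = Finₚ.toℕ-injective
  ; avoiding  = λ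
    { (occ132 _ j<k _ kj) → <-asym j<k kj
    ; (occ213 i<j _ ji _) → <-asym i<j ji
    ; (occ2341 i<j j<k k<l li _ _) → <-asym (<-trans i<j (<-trans j<k k<l)) li
    }
  }

1⊖-admissible : ∀ {n} {w : Fin n → ℕ} → Admissible w → Admissible (1⊖ w)
1⊖-admissible {n} {w} adm = record
  { bounded   = λ { zero → n<1+n n ; (suc i) → m<n⇒m<1+n (bounded adm i) }
  ; injective = injective-cons (λ i → <⇒≢ (bounded adm i)) (injective adm)
  ; avoiding  = avoiding-cons below (avoiding adm)
  }
  where
  below : ∀ {j k : Fin (suc n)} → 0 < toℕ j → j Fin.< k → (1⊖ w) k < n
  below {k = suc k} _ _ = bounded adm k

12⊖-admissible : ∀ {n} {w : Fin n → ℕ} → Admissible w → Admissible (12⊖ w)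
12⊖-admissible {n} {w} adm = record
  { bounded   = λ { zero → m<n⇒m<1+n (n<1+n n) ; (suc zero) → n<1+n (suc n)
                  ; (suc (suc i)) → m<n⇒m<1+n (m<n⇒m<1+n (bounded adm i)) }
  ; injective = injective-cons fresh₀ (injective-cons fresh₁ (injective adm))
  ; avoiding  = avoiding-cons below₀ (avoiding-cons below₁ (avoiding adm))
  }
  where
  fresh₀ : ∀ i → (12⊖ w) (suc i) ≢ n
  fresh₀ zero    = 1+n≢n
  fresh₀ (suc i) = <⇒≢ (bounded adm i)

  fresh₁ : ∀ i → w i ≢ suc n
  fresh₁ i = <⇒≢ (m<n⇒m<1+n (bounded adm i))

  below₀ : ∀ {j k : Fin (suc (suc n))} → 0 < toℕ j → j Fin.< k → (12⊖ w) k < n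
  below₀ {suc _} {suc zero} _ (s<s ())
  below₀ {k = suc (suc k)} _ _ = bounded adm k

  below₁ : ∀ {j k : Fin (suc n)} → 0 < toℕ j → j Fin.< k → (12⊖ w) (suc k) < suc n
  below₁ {k = suc k} _ _ = m<n⇒m<1+n (bounded adm k)

bounded-injective⇒surjective : ∀ {n} {w : Fin n → ℕ} → (∀ i → w i < n) → Injective _≡_ _≡_ w →
                               ∀ {y} → y < n → ∃ λ i → w i ≡ y
bounded-injective⇒surjective {suc n} {w} bounded inj {y} y<n with Finₚ.any? (λ i → w i ≟ y)
... | yes hit = hit
... | no miss = ⊥-elim (1+n≰n (Finₚ.injective⇒≤ punched-injective))
  where
  missed : ∀ i → fromℕ< y<n ≢ fromℕ< (bounded i)
  missed i e = miss (i , sym (trans (sym (Finₚ.toℕ-fromℕ< y<n))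
                                    (trans (cong toℕ e) (Finₚ.toℕ-fromℕ< (bounded i)))))

  punched : Fin (suc n) → Fin n
  punched i = punchOut (missed i)

  punched-injective : Injective _≡_ _≡_ punched
  punched-injective {i} {j} e = inj (begin
    w i                       ≡⟨ sym (Finₚ.toℕ-fromℕ< (bounded i)) ⟩
    toℕ (fromℕ< (bounded i))  ≡⟨ cong toℕ (Finₚ.punchOut-injective (missed i) (missed j) e) ⟩
    toℕ (fromℕ< (bounded j))  ≡⟨ Finₚ.toℕ-fromℕ< (bounded j) ⟩
    w j                       ∎)
    where open ≡-Reasoning

increasing⇒spread : ∀ {n} (w : Fin n → ℕ) → (∀ {i j} → i Fin.< j → w i < w j) →
                    ∀ {i j} → i Fin.≤ j → toℕ j + w i ≤ toℕ i + w j
increasing⇒spread w increasing {zero} {zero} _ = ≤-refl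
increasing⇒spread {suc zero} w increasing {zero} {suc ()}
increasing⇒spread {suc (suc n)} w increasing {zero} {suc j} _ = begin
  suc (toℕ j) + w zero  ≡⟨ sym (+-suc (toℕ j) (w zero)) ⟩
  toℕ j + suc (w zero)  ≤⟨ +-monoʳ-≤ (toℕ j) (increasing {zero} {suc zero} z<s) ⟩
  toℕ j + w (suc zero)  ≤⟨ increasing⇒spread (w ∘ suc) (increasing ∘ s<s) {zero} {j} z≤n ⟩
  w (suc j)             ∎
  where open ≤-Reasoning
increasing⇒spread w increasing {suc i} {suc j} (s≤s i≤j) =
  s≤s (increasing⇒spread (w ∘ suc) (increasing ∘ s<s) i≤j)

increasing-bounded⇒toℕ : ∀ {n} {w : Fin n → ℕ} → (∀ {i j} → i Fin.< j → w i < w j) →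
                         (∀ i → w i < n) → w ≗ toℕ
increasing-bounded⇒toℕ {suc n} {w} increasing bounded i = ≤-antisym upper lower
  where
  lower : toℕ i ≤ w i
  lower = ≤-trans (m≤m+n (toℕ i) (w zero)) (increasing⇒spread w increasing {zero} {i} z≤n)

  upper : w i ≤ toℕ i
  upper = +-cancelˡ-≤ n (w i) (toℕ i) (begin
    n + w i                 ≡⟨ cong (_+ w i) (sym (Finₚ.toℕ-fromℕ n)) ⟩
    toℕ (fromℕ n) + w i     ≤⟨ increasing⇒spread w increasing (Finₚ.≤fromℕ i) ⟩
    toℕ i + w (fromℕ n)     ≤⟨ +-monoʳ-≤ (toℕ i) (≤-pred (bounded (fromℕ n))) ⟩
    toℕ i + n               ≡⟨ +-comm (toℕ i) n ⟩
    n + toℕ i               ∎)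
    where open ≤-Reasoning

module _ {m} {w : Fin (suc m) → ℕ} (adm : Admissible w) where

  surjective : ∀ {y} → y < suc m → ∃ λ i → w i ≡ y
  surjective = bounded-injective⇒surjective (bounded adm) (injective adm)

  head-zero⇒toℕ : w zero ≡ 0 → w ≗ toℕ
  head-zero⇒toℕ w₀≡0 = increasing-bounded⇒toℕ increasing (bounded adm)
    where
    above-head : ∀ j → 0 < toℕ j → w zero < w j
    above-head (suc j) _ = subst (_< w (suc j)) (sym w₀≡0)
      (n≢0⇒n>0 (λ wj≡0 → Finₚ.0≢1+n (injective adm (trans w₀≡0 (sym wj≡0)))))

    -- a descent after the head 0 would give a 132
    increasing : ∀ {i j} → i Fin.< j → w i < w j
    increasing {zero} {j} 0<j = above-head j 0<j
    increasing {suc i} {j} i<j with <-cmp (w (suc i)) (w j)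
    ... | tri< wi<wj _ _ = wi<wj
    ... | tri≈ _ wi≡wj _ = ⊥-elim (<-irrefl (cong toℕ (injective adm wi≡wj)) i<j)
    ... | tri> _ _ wj<wi = ⊥-elim (avoiding adm
            (occ132 {i = zero} z<s i<j (above-head j (<-trans z<s i<j)) wj<wi))

fresh-below : ∀ {n} {w : Fin (suc n) → ℕ} → Injective _≡_ _≡_ w →
              ∀ {v} → w zero ≡ v → ∀ i → w (suc i) ≤ v → w (suc i) < v
fresh-below inj w₀≡v i wi≤v = ≤∧≢⇒< wi≤v (λ wi≡v → Finₚ.0≢1+n (inj (trans w₀≡v (sym wi≡v))))

tail-admissible : ∀ {m} {w : Fin (suc m) → ℕ} → Admissible w → w zero ≡ m → Admissible (w ∘ suc)
tail-admissible adm w₀≡m = record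
  { bounded   = λ i → fresh-below (injective adm) w₀≡m i (≤-pred (bounded adm (suc i)))
  ; injective = Finₚ.suc-injective ∘ injective adm
  ; avoiding  = avoiding adm ∘ forbidden-suc
  }

tail₂-admissible : ∀ {m} {w : Fin (suc (suc m)) → ℕ} → Admissible w →
                   w zero ≡ m → w (suc zero) ≡ suc m → Admissible (λ i → w (suc (suc i)))
tail₂-admissible adm w₀≡m w₁≡1+m = record
  { bounded   = λ i → fresh-below (injective adm) w₀≡m (suc i) (≤-pred
                  (fresh-below (Finₚ.suc-injective ∘ injective adm) w₁≡1+m i (≤-pred (bounded adm (suc (suc i))))))
  ; injective = Finₚ.suc-injective ∘ Finₚ.suc-injective ∘ injective adm
  ; avoiding  = avoiding adm ∘ forbidden-suc ∘ forbidden-suc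
  }

module _ {m} {w : Fin (suc (suc m)) → ℕ} (adm : Admissible w)
         (w₀≢0 : w zero ≢ 0) (w₀≢max : w zero ≢ suc m) where

  private
    head<max : w zero < suc m
    head<max = ≤∧≢⇒< (≤-pred (bounded adm zero)) w₀≢max

    entry-≢ : ∀ {i j} → i ≢ j → w i ≢ w j
    entry-≢ i≢j = i≢j ∘ injective adm

    -- With the maximum at p ≥ 2, the entry 0 lies after it (else a 213), and then
    -- the entry at position 1 starts a 213 or is the 3 of a 2341.
    max-not-beyond-second : ∀ p q → w (suc (suc p)) ≡ suc m → w (suc q) ≢ 0
    max-not-beyond-second p q wp≡max wq≡0 = contradiction
      where
      wq<w₀ : w (suc q) < w zero
      wq<w₀ = subst (_< w zero) (sym wq≡0) (n≢0⇒n>0 w₀≢0)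

      w₀<wp : w zero < w (suc (suc p))
      w₀<wp = subst (w zero <_) (sym wp≡max) head<max

      w₁<wp : w (suc zero) < w (suc (suc p))
      w₁<wp = subst (w (suc zero) <_) (sym wp≡max) (≤∧≢⇒< (≤-pred (bounded adm (suc zero)))
                (λ w₁≡max → entry-≢ (λ ()) (trans w₁≡max (sym wp≡max))))

      contradiction : ⊥
      contradiction with Finₚ.<-cmp (suc q) (suc (suc p))
      ... | tri< q<p _ _ = avoiding adm (occ213 {i = zero} z<s q<p wq<w₀ w₀<wp)
      ... | tri≈ _ q≡p _ = 0≢1+n (trans (sym wq≡0) (trans (cong w q≡p) wp≡max))
      ... | tri> _ _ p<q with <-cmp (w (suc zero)) (w zero)
      ...   | tri< w₁<w₀ _ _ = avoiding adm (occ213 {i = zero} z<s (s<s z<s) w₁<w₀ w₀<wp)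
      ...   | tri≈ _ w₁≡w₀ _ = entry-≢ (λ ()) w₁≡w₀
      ...   | tri> _ _ w₀<w₁ = avoiding adm (occ2341 {i = zero} z<s (s<s z<s) p<q wq<w₀ w₀<w₁ w₁<wp)

  second-is-max : w (suc zero) ≡ suc m
  second-is-max with surjective adm (n<1+n (suc m)) | surjective adm {0} z<s
  ... | zero , w₀≡max | _ = ⊥-elim (w₀≢max w₀≡max)
  ... | _ | zero , w₀≡0 = ⊥-elim (w₀≢0 w₀≡0)
  ... | suc zero , w₁≡max | _ = w₁≡max
  ... | suc (suc p) , wp≡max | suc q , wq≡0 = ⊥-elim (max-not-beyond-second p q wp≡max wq≡0)

  -- If w₀ < m, the entry w₀ + 1 comes after the first two entries and forms a 132 with them.
  head-is-submax : w zero ≡ m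
  head-is-submax with m≤n⇒m<n∨m≡n (≤-pred head<max)
  ... | inj₂ w₀≡m = w₀≡m
  ... | inj₁ w₀<m with surjective adm {suc (w zero)} (s<s head<max)
  ...   | zero , w₀≡1+w₀ = ⊥-elim (1+n≢n (sym w₀≡1+w₀))
  ...   | suc zero , w₁≡1+w₀ = ⊥-elim (<⇒≢ w₀<m (suc-injective (trans (sym w₁≡1+w₀) second-is-max)))
  ...   | suc (suc r) , wr≡1+w₀ = ⊥-elim (avoiding adm (occ132 {i = zero} z<s (s<s z<s)
            (subst (w zero <_) (sym wr≡1+w₀) (n<1+n (w zero)))
            (subst₂ _<_ (sym wr≡1+w₀) (sym second-is-max) (s<s w₀<m))))

-- DominoTiling n ts: the tiles ts cover a 1 × (n + 1) board and include a domino.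
data DominoTiling : ℕ → List Tile → Set where
  domino∷squares : ∀ {n} → DominoTiling (suc n) (domino ∷ replicate n square)
  square∷_       : ∀ {n ts} → DominoTiling n ts → DominoTiling (suc n) (square ∷ ts)
  domino∷_       : ∀ {n ts} → DominoTiling n ts → DominoTiling (suc (suc n)) (domino ∷ ts)

squares-¬dominoTiling : ∀ {n} k → ¬ DominoTiling n (replicate k square)
squares-¬dominoTiling (suc k) (square∷ t) = squares-¬dominoTiling k t

dominoTiling-irrelevant : ∀ {n ts} (t u : DominoTiling n ts) → t ≡ u
dominoTiling-irrelevant domino∷squares domino∷squares = refl
dominoTiling-irrelevant domino∷squares (domino∷ u)    = ⊥-elim (squares-¬dominoTiling _ u)
dominoTiling-irrelevant (domino∷ t)    domino∷squares = ⊥-elim (squares-¬dominoTiling _ t)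
dominoTiling-irrelevant (square∷ t)    (square∷ u)    = cong square∷_ (dominoTiling-irrelevant t u)
dominoTiling-irrelevant (domino∷ t)    (domino∷ u)    = cong domino∷_ (dominoTiling-irrelevant t u)

dominoTiling-≡ : ∀ {n} {x y : ∃ (DominoTiling n)} → proj₁ x ≡ proj₁ y → x ≡ y
dominoTiling-≡ {x = _ , t} {_ , u} refl = cong (_ ,_) (dominoTiling-irrelevant t u)

totalLength-squares : ∀ k → totalLength (replicate k square) ≡ k
totalLength-squares zero    = refl
totalLength-squares (suc k) = cong suc (totalLength-squares k)

dominoTiling⇒totalLength : ∀ {n ts} → DominoTiling n ts → totalLength ts ≡ suc n
dominoTiling⇒totalLength {suc n} domino∷squares = cong (2 +_) (totalLength-squares n)
dominoTiling⇒totalLength (square∷ t) = cong suc (dominoTiling⇒totalLength t)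
dominoTiling⇒totalLength (domino∷ t) = cong (2 +_) (dominoTiling⇒totalLength t)

dominoTiling⇒domino : ∀ {n ts} → DominoTiling n ts → Any (_≡ domino) ts
dominoTiling⇒domino domino∷squares = here refl
dominoTiling⇒domino (square∷ t)    = there (dominoTiling⇒domino t)
dominoTiling⇒domino (domino∷ t)    = here refl

data SquaresOrDomino : List Tile → Set where
  squares    : ∀ k → SquaresOrDomino (replicate k square)
  withDomino : ∀ {ts} → Any (_≡ domino) ts → SquaresOrDomino ts

squaresOrDomino : ∀ ts → SquaresOrDomino ts
squaresOrDomino []            = squares 0
squaresOrDomino (domino ∷ ts) = withDomino (here refl)
squaresOrDomino (square ∷ ts) with squaresOrDomino ts
... | squares k    = squares (suc k)
... | withDomino d = withDomino (there d)

tiling⇒dominoTiling : ∀ {n} ts → totalLength ts ≡ suc n → Any (_≡ domino) ts → DominoTiling n ts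
tiling⇒dominoTiling (square ∷ ts) _ (here ())
tiling⇒dominoTiling {zero} (square ∷ []) _ (there ())
tiling⇒dominoTiling {zero} (square ∷ square ∷ _) () _
tiling⇒dominoTiling {zero} (square ∷ domino ∷ _) () _
tiling⇒dominoTiling {suc n} (square ∷ ts) len (there d) =
  square∷ tiling⇒dominoTiling ts (suc-injective len) d
tiling⇒dominoTiling (domino ∷ ts) len _ with squaresOrDomino ts
tiling⇒dominoTiling {n} (domino ∷ _) len _ | squares k =
  subst (λ n → DominoTiling n _) (trans (sym (cong suc (totalLength-squares k))) (suc-injective len)) domino∷squares
tiling⇒dominoTiling {suc (suc n)} (domino ∷ ts) len _ | withDomino d =
  domino∷ tiling⇒dominoTiling ts (suc-injective (suc-injective len)) d
tiling⇒dominoTiling {suc zero} (domino ∷ []) _ _ | withDomino ()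
tiling⇒dominoTiling {suc zero} (domino ∷ square ∷ _) () _ | _
tiling⇒dominoTiling {suc zero} (domino ∷ domino ∷ _) () _ | _

encode : ∀ {n ts} → DominoTiling n ts → Fin n → ℕ
encode domino∷squares = toℕ
encode (square∷ t)    = 1⊖ encode t
encode (domino∷ t)    = 12⊖ encode t

encode-admissible : ∀ {n ts} (t : DominoTiling n ts) → Admissible (encode t)
encode-admissible domino∷squares = toℕ-admissible
encode-admissible (square∷ t)    = 1⊖-admissible (encode-admissible t)
encode-admissible (domino∷ t)    = 12⊖-admissible (encode-admissible t)

-- The first entry, 0, n ∸ 1 or n ∸ 2 according to the first tile, tells the tilings apart.
encode-injective : ∀ {n ts us} (t : DominoTiling n ts) (u : DominoTiling n us) →
                   encode t ≗ encode u → (ts , t) ≡ (us , u)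
encode-injective domino∷squares domino∷squares _ = refl
encode-injective (square∷ t) (square∷ u) eq with encode-injective t u (eq ∘ suc)
... | refl = refl
encode-injective (domino∷ t) (domino∷ u) eq with encode-injective t u (λ i → eq (suc (suc i)))
... | refl = refl
encode-injective {suc zero} domino∷squares (square∷ ())
encode-injective {suc (suc _)} domino∷squares (square∷ _) eq = ⊥-elim (0≢1+n (eq zero))
encode-injective {suc zero} (square∷ ()) domino∷squares
encode-injective {suc (suc _)} (square∷ _) domino∷squares eq = ⊥-elim (0≢1+n (sym (eq zero)))
encode-injective {suc (suc zero)} domino∷squares (domino∷ ())
encode-injective {suc (suc (suc _))} domino∷squares (domino∷ _) eq = ⊥-elim (0≢1+n (eq zero))
encode-injective {suc (suc zero)} (domino∷ ()) domino∷squares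
encode-injective {suc (suc (suc _))} (domino∷ _) domino∷squares eq = ⊥-elim (0≢1+n (sym (eq zero)))
encode-injective (square∷ _) (domino∷ _) eq = ⊥-elim (1+n≢n (eq zero))
encode-injective (domino∷ _) (square∷ _) eq = ⊥-elim (1+n≢n (sym (eq zero)))

decode : ∀ {m} {w : Fin (suc m) → ℕ} → Admissible w →
         Σ (List Tile) λ ts → Σ (DominoTiling (suc m) ts) λ t → encode t ≗ w
decode {m} {w} adm with w zero ≟ 0
... | yes w₀≡0 = _ , domino∷squares , sym ∘ head-zero⇒toℕ adm w₀≡0
decode {zero} adm | no w₀≢0 = ⊥-elim (w₀≢0 (n<1⇒n≡0 (bounded adm zero)))
decode {suc m} {w} adm | no w₀≢0 with w zero ≟ suc m
... | yes w₀≡max =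
  let ts , t , t≗w = decode (tail-admissible adm w₀≡max)
  in  square ∷ ts , square∷ t , λ { zero → sym w₀≡max ; (suc i) → t≗w i }
decode {suc zero} adm | no w₀≢0 | no w₀≢max = ⊥-elim (w₀≢0 (head-is-submax adm w₀≢0 w₀≢max))
decode {suc (suc m)} {w} adm | no w₀≢0 | no w₀≢max =
  let w₀≡m  = head-is-submax adm w₀≢0 w₀≢max
      w₁≡1+m = second-is-max adm w₀≢0 w₀≢max
      ts , t , t≗w = decode (tail₂-admissible adm w₀≡m w₁≡1+m)
  in  domino ∷ ts , domino∷ t , λ { zero → sym w₀≡m ; (suc zero) → sym w₁≡1+m ; (suc (suc i)) → t≗w i }

permutations↔dominoTilings : ∀ m →
  Inverse (Sn-132-213-2341-setoid (suc m)) (setoid (∃ (DominoTiling (suc m))))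
permutations↔dominoTilings m = record
  { to        = to
  ; from      = from
  ; to-cong   = λ {x} {y} → to-resp {x} {y}
  ; from-cong = cong (proj₁ ∘ from)
  ; inverse   = (λ {x} {y} π≡π′ → trans (to-resp {y} {from x} π≡π′) (to∘from x))
              , (λ { {x} refl → from∘to x })
  }
  where
  to : Sn-132-213-2341 (suc m) → ∃ (DominoTiling (suc m))
  to x = let ts , t , _ = decode (sn⇒admissible x) in ts , t

  to-≗ : ∀ x → encode (proj₂ (to x)) ≗ entries (proj₁ x)
  to-≗ x = proj₂ (proj₂ (decode (sn⇒admissible x)))

  permutation : ∀ {ts} → DominoTiling (suc m) ts → Vec (Fin (suc m)) (suc m)
  permutation t = tabulateBounded (encode t) (bounded (encode-admissible t))

  entries-permutation : ∀ {ts} (t : DominoTiling (suc m) ts) → entries (permutation t) ≗ encode t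
  entries-permutation t = entries-tabulateBounded (encode t) (bounded (encode-admissible t))

  from : ∃ (DominoTiling (suc m)) → Sn-132-213-2341 (suc m)
  from (_ , t) = admissible⇒sn {π = permutation t}
    (admissible-resp-≗ (sym ∘ entries-permutation t) (encode-admissible t))

  to-resp : ∀ {x y} → proj₁ x ≡ proj₁ y → to x ≡ to y
  to-resp {x} {y} π≡π′ = encode-injective (proj₂ (to x)) (proj₂ (to y)) λ i →
    trans (to-≗ x i) (trans (cong (λ π → entries π i) π≡π′) (sym (to-≗ y i)))

  to∘from : ∀ x → to (from x) ≡ x
  to∘from x@(_ , t) = encode-injective (proj₂ (to (from x))) t λ i →
    trans (to-≗ (from x) i) (entries-permutation t i)

  from∘to : ∀ x → proj₁ (from (to x)) ≡ proj₁ x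
  from∘to x = entries-injective λ i → trans (entries-permutation (proj₂ (to x)) i) (to-≗ x i)

dominoTilings↔tilings : ∀ n → Inverse (setoid (∃ (DominoTiling n))) (TilingWithDomino-setoid (suc n))
dominoTilings↔tilings n = record
  { to        = λ (ts , t) → ts , dominoTiling⇒totalLength t , dominoTiling⇒domino t
  ; from      = λ (ts , len , d) → ts , tiling⇒dominoTiling ts len d
  ; to-cong   = cong proj₁
  ; from-cong = dominoTiling-≡
  ; inverse   = cong proj₁ , dominoTiling-≡
  }

dominoTilingCount : ℕ → ℕ
dominoTilingCount zero          = 0
dominoTilingCount (suc zero)    = 1
dominoTilingCount (suc (suc n)) = suc (dominoTilingCount (suc n) + dominoTilingCount n)

suc-dominoTilingCount : ∀ n → suc (dominoTilingCount n) ≡ F (suc (suc n))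
suc-dominoTilingCount zero          = refl
suc-dominoTilingCount (suc zero)    = refl
suc-dominoTilingCount (suc (suc n)) = begin
  suc (suc (dominoTilingCount (suc n) + dominoTilingCount n))  ≡⟨ cong suc (sym (+-suc _ _)) ⟩
  suc (dominoTilingCount (suc n)) + suc (dominoTilingCount n)  ≡⟨ cong₂ _+_ (suc-dominoTilingCount (suc n)) (suc-dominoTilingCount n) ⟩
  F (suc (suc (suc n))) + F (suc (suc n))                      ∎
  where open ≡-Reasoning

dominoTilingCount≡F : ∀ n → dominoTilingCount n ≡ F (n + 2) ∸ 1
dominoTilingCount≡F n = sym (begin
  F (n + 2) ∸ 1          ≡⟨ cong (λ k → F k ∸ 1) (+-comm n 2) ⟩
  F (2 + n) ∸ 1          ≡⟨ cong (_∸ 1) (sym (suc-dominoTilingCount n)) ⟩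
  dominoTilingCount n    ∎)
  where open ≡-Reasoning

toFin : ∀ {n ts} → DominoTiling n ts → Fin (dominoTilingCount n)
toFin (domino∷squares {zero})  = zero
toFin (domino∷squares {suc _}) = zero
toFin (square∷_ {zero} ())
toFin (square∷_ {suc n} t)     = suc (toFin t ↑ˡ dominoTilingCount n)
toFin (domino∷_ {n} t)         = suc (dominoTilingCount (suc n) ↑ʳ toFin t)

fromSplit : ∀ {n} → (Fin (dominoTilingCount (suc n)) → ∃ (DominoTiling (suc n))) →
            (Fin (dominoTilingCount n) → ∃ (DominoTiling n)) →
            Fin (dominoTilingCount (suc n)) ⊎ Fin (dominoTilingCount n) → ∃ (DominoTiling (suc (suc n)))
fromSplit f g (inj₁ i) = map (square ∷_) square∷_ (f i)
fromSplit f g (inj₂ i) = map (domino ∷_) domino∷_ (g i)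

fromFin : ∀ {n} → Fin (dominoTilingCount n) → ∃ (DominoTiling n)
fromFin {suc zero}    zero    = _ , domino∷squares
fromFin {suc (suc n)} zero    = _ , domino∷squares
fromFin {suc (suc n)} (suc i) = fromSplit fromFin fromFin (splitAt (dominoTilingCount (suc n)) i)

toFin∘fromSplit : ∀ {n} →
  (∀ i → toFin (proj₂ (fromFin {suc n} i)) ≡ i) → (∀ i → toFin (proj₂ (fromFin {n} i)) ≡ i) →
  ∀ s → toFin (proj₂ (fromSplit fromFin fromFin s)) ≡ suc (join (dominoTilingCount (suc n)) (dominoTilingCount n) s)
toFin∘fromSplit f g (inj₁ i) = cong (λ j → suc (j ↑ˡ _)) (f i)
toFin∘fromSplit f g (inj₂ i) = cong (λ j → suc (_ ↑ʳ j)) (g i)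

toFin∘fromFin : ∀ {n} (i : Fin (dominoTilingCount n)) → toFin (proj₂ (fromFin i)) ≡ i
toFin∘fromFin {suc zero}    zero    = refl
toFin∘fromFin {suc (suc n)} zero    = refl
toFin∘fromFin {suc (suc n)} (suc i) = trans
  (toFin∘fromSplit (toFin∘fromFin {suc n}) (toFin∘fromFin {n}) (splitAt _ i))
  (cong suc (Finₚ.join-splitAt (dominoTilingCount (suc n)) (dominoTilingCount n) i))

fromFin∘toFin : ∀ {n ts} (t : DominoTiling n ts) → fromFin (toFin t) ≡ (ts , t)
fromFin∘toFin (domino∷squares {zero})  = refl
fromFin∘toFin (domino∷squares {suc _}) = refl
fromFin∘toFin (square∷_ {suc n} t)
  rewrite Finₚ.splitAt-↑ˡ (dominoTilingCount (suc n)) (toFin t) (dominoTilingCount n)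
        | fromFin∘toFin t = refl
fromFin∘toFin (domino∷_ {n} t)
  rewrite Finₚ.splitAt-↑ʳ (dominoTilingCount (suc n)) (dominoTilingCount n) (toFin t)
        | fromFin∘toFin t = refl

dominoTilings↔Fin : ∀ n → Inverse (setoid (∃ (DominoTiling n))) (setoid (Fin (dominoTilingCount n)))
dominoTilings↔Fin n = record
  { to        = toFin ∘ proj₂
  ; from      = fromFin
  ; to-cong   = cong (toFin ∘ proj₂)
  ; from-cong = cong fromFin
  ; inverse   = (λ { {i} refl → toFin∘fromFin i }) , (λ { {_ , t} refl → fromFin∘toFin t })
  }

proposition4p2 : (n : ℕ) → 1 ≤ n →
    Inverse (Sn-132-213-2341-setoid n) (TilingWithDomino-setoid (n + 1))
    × Inverse (Sn-132-213-2341-setoid n) (setoid (Fin (F (n + 2) ∸ 1)))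
proposition4p2 (suc m) _ =
    subst (Inverse Sₙ ∘ TilingWithDomino-setoid) (+-comm 1 (suc m))
      (Compose.inverse permutations (dominoTilings↔tilings (suc m)))
  , subst (Inverse Sₙ ∘ setoid ∘ Fin) (dominoTilingCount≡F (suc m))
      (Compose.inverse permutations (dominoTilings↔Fin (suc m)))
  where
  Sₙ : Setoid 0ℓ 0ℓ
  Sₙ = Sn-132-213-2341-setoid (suc m)

  permutations : Inverse Sₙ (setoid (∃ (DominoTiling (suc m))))
  permutations = permutations↔dominoTilings m
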